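{- Let $b_q'$ be any vertex in $S$. Then, $(G, l, I_{\mathrm{ini}}, s)$ is a yes-instance if and only if $(G \setminus \{b_q'\}, l, I_{\mathrm{ini}}, s)$ is.
   Context: For an integer $l \ge 0$, two independent sets $I_p, I_q$ of a graph $G$ with $|I_p|, |I_q| \ge l$ are reachable under the $\mathsf{TAR}(l)$ rule if there is a sequence $\langle I_1, \ldots, I_\ell \rangle$ of independent sets of $G$ with $I_1 = I_p$, $I_\ell = I_q$, $|I_i| \ge l$ for all $i$, and $|I_i \triangle I_{i+1}| = 1$ for all $i$. Opt-ISR parameterized by solution size $s$: given an instance $(G, l, I_{\mathrm{ini}}, s)$, decide whether $G$ has an independent set $I$ with $|I| \ge s$ reachable from $I_{\mathrm{ini}}$ under the $\mathsf{TAR}(l)$ rule. Let $(G,l,I_{\mathrm{ini}},s)$ be such an instance where $G$ is $d$-degenerate and $|I_{\mathrm{ini}}| < s$. Let $D$ be the set of vertices of $G$ of degree at most $2d$ and $D' = D \setminus I_{\mathrm{ini}}$; assume that no two vertices of $D'$ have the same closed neighborhood $N_G[\cdot]$ and that $|D'| > f(s,d) = (2d + 1)!((2s + d + 1) - 1)^{2d + 1}$. A family $\{P_1, \ldots, P_p\}$ of non-empty sets is a sunflower with core $C$ if $P_i \setminus C \neq \emptyset$ for each $i$ and $P_i \cap P_j = C$ for all $i \neq j$. By the Sunflower Lemma (with set size bound $t = 2d+1$ and $p = 2s + d + 1$) applied to the family $\{N_G[b] : b \in D'\}$, there is a sunflower with a core $C$ and $p$ petals consisting of closed neighborhoods of vertices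 of $D'$; $S = \{b_1', \ldots, b_p'\} \subseteq D'$ is the set of $p$ vertices whose closed neighborhoods form this sunflower. -}

module Defs where

open import Data.Nat using (ℕ; suc; _+_; _*_; _^_; _≤_; _<_)
open import Data.Nat using (_!; _∸_; _≤ᵇ_)
open import Data.Bool using (Bool; true; false)
open import Data.Fin using (Fin; punchIn)
open import Data.Fin.Subset using (Subset; _∈_; _∉_; _⊆_; _∩_; _∪_; _─_; ∣_∣; ⁅_⁆; Nonempty)
open import Data.Vec using (tabulate; lookup)
open import Data.Product using (_×_; Σ)
open import Relation.Binary.PropositionalEquality using (_≡_; _≢_)
open import Relation.Binary.Construct.Closure.ReflexiveTransitive using (Star)

record Graph (n : ℕ) : Set where
  field
    adj       : Fin n → Fin n → Bool
    adj-sym   : ∀ u v → adj u v ≡ adj v u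
    adj-irrefl : ∀ v → adj v v ≡ false
open Graph public

module _ {n : ℕ} (G : Graph n) where

  N : Fin n → Subset n
  N v = tabulate (adj G v)

  N[_] : Fin n → Subset n
  N[ v ] = N v ∪ ⁅ v ⁆

  degree : Fin n → ℕ
  degree v = ∣ N v ∣

  Independent : Subset n → Set
  Independent I = ∀ u v → u ∈ I → v ∈ I → adj G u v ≡ false

  Degenerate : ℕ → Set
  Degenerate d = ∀ (U : Subset n) → Nonempty U →
    Σ (Fin n) λ v → v ∈ U × ∣ N v ∩ U ∣ ≤ d

_△_ : {n : ℕ} → Subset n → Subset n → Subset n
I △ J = (I ─ J) ∪ (J ─ I)

module _ {n : ℕ} (G : Graph n) (l : ℕ) where

  Valid : Subset n → Set
  Valid I = Independent G I × l ≤ ∣ I ∣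

  TARStep : Subset n → Subset n → Set
  TARStep I J = Valid I × Valid J × ∣ I △ J ∣ ≡ 1

  TARReachable : Subset n → Subset n → Set
  TARReachable Ip Iq = Valid Ip × Star TARStep Ip Iq

YesInstance : {n : ℕ} → Graph n → ℕ → Subset n → ℕ → Set
YesInstance {n} G l Iini s =
  Σ (Subset n) λ I → s ≤ ∣ I ∣ × TARReachable G l Iini I

-- G ∖ {b}: delete vertex b; the vertices of G ∖ {b} are Fin m, where
-- i : Fin m stands for the vertex punchIn b i of G.
deleteVertex : {m : ℕ} → Graph (suc m) → Fin (suc m) → Graph m
deleteVertex G b = record
  { adj        = λ i j → adj G (punchIn b i) (punchIn b j)
  ; adj-sym    = λ i j → adj-sym G (punchIn b i) (punchIn b j)
  ; adj-irrefl = λ i → adj-irrefl G (punchIn b i)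
  }

restrict : {m : ℕ} → Subset (suc m) → Fin (suc m) → Subset m
restrict I b = tabulate λ i → lookup I (punchIn b i)

lowDeg : {n : ℕ} → Graph n → ℕ → Subset n
lowDeg G d = tabulate λ v → degree G v ≤ᵇ 2 * d

f : ℕ → ℕ → ℕ
f s d = (2 * d + 1) ! * ((2 * s + d + 1) ∸ 1) ^ (2 * d + 1)

SunflowerNbhd : {n : ℕ} → Graph n → Subset n → Subset n → Set
SunflowerNbhd G S C =
  (∀ b → b ∈ S → Nonempty (N[_] G b ─ C)) ×
  (∀ b b' → b ∈ S → b' ∈ S → b ≢ b' → N[_] G b ∩ N[_] G b' ≡ C)

{-# OPTIONS --safe #-}
-- A TAR(l) sequence that never uses b is literally a sequence of G ∖ b, so only
-- sequences through b need repair. Follow a sequence from I_ini reaching size s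
-- up to the first step that adds b: the current set K is then disjoint from
-- N[b], hence from the core C ⊆ N[b]. Since G is d-degenerate and C lies in
-- every petal, at most d + 1 vertices of S belong to C, leaving at least s
-- vertices v ∈ S ∖ C other than b, whose neighbourhoods N[v] ∖ C are pairwise
-- disjoint. While |K| < s, pigeonhole gives such a v with N[v] disjoint from K,
-- and adding v is a TAR step; so size s is reached without ever touching b.
module Submission where

open import Data.Bool using (true; false)
open import Data.Fin using (Fin; zero; suc; punchIn; punchOut)
open import Data.Fin.Properties using (punchIn-punchOut) renaming (_≟_ to _≟ᶠ_)
open import Data.Fin.Subset
open import Data.Fin.Subset.Properties
open import Data.Nat using (ℕ; zero; suc; _+_; _*_; _≤_; _<_; _≤?_; z≤n; s≤s)
open import Data.Nat.Properties
open import Data.Nat.Solver using (module +-*-Solver)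
open import Data.Product using (_×_; _,_; Σ; ∃; proj₁; proj₂)
open import Data.Sum using (inj₁; inj₂)
open import Data.Vec using (Vec; []; _∷_; here; there; lookup; insertAt; zipWith)
open import Data.Vec.Properties
  using (lookup∘tabulate; tabulate∘lookup; insertAt-punchIn; insertAt-lookup; []=⇒lookup; lookup⇒[]=)
open import Function.Base using (_∘_)
open import Function.Bundles using (_⇔_; mk⇔; Equivalence)
open import Relation.Binary.Construct.Closure.ReflexiveTransitive using (Star; ε; _◅_; gmap)
open import Relation.Binary.PropositionalEquality
open import Relation.Nullary using (yes; no; contradiction)
open import Defs

private variable
  m n : ℕ
  p q : Subset n
  x y : Fin n

lookup≡outside⇒∉ : lookup p x ≡ outside → x ∉ p
lookup≡outside⇒∉ eq x∈p with () ← trans (sym ([]=⇒lookup x∈p)) eq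

x∈p─q⇒x∉q : ∀ (p q : Subset n) {x} → x ∈ p ─ q → x ∉ q
x∈p─q⇒x∉q (s ∷ p) (inside ∷ q) {zero} ()
x∈p─q⇒x∉q (s ∷ p) (outside ∷ q) {zero} _ ()
x∈p─q⇒x∉q (s ∷ p) (t ∷ q) {suc x} (there x∈) (there x∈q) = x∈p─q⇒x∉q p q x∈ x∈q

Empty⇒∣p∣≡0 : ∀ {n} {p : Subset n} → Empty p → ∣ p ∣ ≡ 0
Empty⇒∣p∣≡0 {n} e = trans (cong ∣_∣ (Empty-unique e)) (∣⊥∣≡0 n)

0<∣p∣⇒Nonempty : 0 < ∣ p ∣ → Nonempty p
0<∣p∣⇒Nonempty {p = p} pos with nonempty? p
... | yes ne = ne
... | no e = contradiction (Empty⇒∣p∣≡0 e) (>⇒≢ pos)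

x∈p⇒0<∣p∣ : x ∈ p → 0 < ∣ p ∣
x∈p⇒0<∣p∣ x∈p = ≤-trans (s≤s z≤n) (x∈p⇒∣p-x∣<∣p∣ x∈p)

x∈p∧y∈p∧x≢y⇒1<∣p∣ : x ∈ p → y ∈ p → x ≢ y → 1 < ∣ p ∣
x∈p∧y∈p∧x≢y⇒1<∣p∣ x∈p y∈p x≢y =
  ≤-trans (s≤s (x∈p⇒0<∣p∣ (x∈p∧x≢y⇒x∈p-y y∈p (≢-sym x≢y)))) (x∈p⇒∣p-x∣<∣p∣ x∈p)

∣p∣≤∣p─q∣+∣p∩q∣ : ∀ (p q : Subset n) → ∣ p ∣ ≤ ∣ p ─ q ∣ + ∣ p ∩ q ∣
∣p∣≤∣p─q∣+∣p∩q∣ []            []            = z≤n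
∣p∣≤∣p─q∣+∣p∩q∣ (inside ∷ p)  (inside ∷ q)  =
  ≤-trans (s≤s (∣p∣≤∣p─q∣+∣p∩q∣ p q)) (≤-reflexive (sym (+-suc _ _)))
∣p∣≤∣p─q∣+∣p∩q∣ (inside ∷ p)  (outside ∷ q) = s≤s (∣p∣≤∣p─q∣+∣p∩q∣ p q)
∣p∣≤∣p─q∣+∣p∩q∣ (outside ∷ p) (inside ∷ q)  = ∣p∣≤∣p─q∣+∣p∩q∣ p q
∣p∣≤∣p─q∣+∣p∩q∣ (outside ∷ p) (outside ∷ q) = ∣p∣≤∣p─q∣+∣p∩q∣ p q

∣p∣≤1+∣p-x∣ : ∀ (p : Subset n) x → ∣ p ∣ ≤ suc ∣ p - x ∣
∣p∣≤1+∣p-x∣ p x = begin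
  ∣ p ∣                         ≤⟨ ∣p∣≤∣p─q∣+∣p∩q∣ p ⁅ x ⁆ ⟩
  ∣ p - x ∣ + ∣ p ∩ ⁅ x ⁆ ∣     ≤⟨ +-monoʳ-≤ ∣ p - x ∣ (∣p∩q∣≤∣q∣ p ⁅ x ⁆) ⟩
  ∣ p - x ∣ + ∣ ⁅ x ⁆ ∣         ≡⟨ cong (∣ p - x ∣ +_) (∣⁅x⁆∣≡1 x) ⟩
  ∣ p - x ∣ + 1                 ≡⟨ +-comm ∣ p - x ∣ 1 ⟩
  suc ∣ p - x ∣                 ∎
  where open ≤-Reasoning

∣p∪⁅x⁆∣≡1+∣p∣ : ∀ (p : Subset n) x → x ∉ p → ∣ p ∪ ⁅ x ⁆ ∣ ≡ suc ∣ p ∣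
∣p∪⁅x⁆∣≡1+∣p∣ (outside ∷ p) zero    _   = cong (suc ∘ ∣_∣) (∪-identityʳ p)
∣p∪⁅x⁆∣≡1+∣p∣ (inside ∷ p)  zero    x∉p = contradiction here x∉p
∣p∪⁅x⁆∣≡1+∣p∣ (inside ∷ p)  (suc x) x∉p = cong suc (∣p∪⁅x⁆∣≡1+∣p∣ p x (x∉p ∘ there))
∣p∪⁅x⁆∣≡1+∣p∣ (outside ∷ p) (suc x) x∉p = ∣p∪⁅x⁆∣≡1+∣p∣ p x (x∉p ∘ there)

∣p△p∣≡0 : ∀ (p : Subset n) → ∣ p △ p ∣ ≡ 0
∣p△p∣≡0 []            = refl
∣p△p∣≡0 (inside ∷ p)  = ∣p△p∣≡0 p
∣p△p∣≡0 (outside ∷ p) = ∣p△p∣≡0 p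

∣p△p∪⁅x⁆∣≡1 : ∀ (p : Subset n) x → x ∉ p → ∣ p △ (p ∪ ⁅ x ⁆) ∣ ≡ 1
∣p△p∪⁅x⁆∣≡1 (outside ∷ p) zero    _   =
  cong suc (trans (cong (λ q → ∣ p △ q ∣) (∪-identityʳ p)) (∣p△p∣≡0 p))
∣p△p∪⁅x⁆∣≡1 (inside ∷ p)  zero    x∉p = contradiction here x∉p
∣p△p∪⁅x⁆∣≡1 (inside ∷ p)  (suc x) x∉p = ∣p△p∪⁅x⁆∣≡1 p x (x∉p ∘ there)
∣p△p∪⁅x⁆∣≡1 (outside ∷ p) (suc x) x∉p = ∣p△p∪⁅x⁆∣≡1 p x (x∉p ∘ there)

∣p△q∣≡1∧x∈q─p⇒p⊆q : ∣ p △ q ∣ ≡ 1 → x ∉ p → x ∈ q → p ⊆ q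
∣p△q∣≡1∧x∈q─p⇒p⊆q {p = p} {q} {x} ∣p△q∣≡1 x∉p x∈q {y} y∈p with y ∈? q
... | yes y∈q = y∈q
... | no  y∉q = contradiction ∣p△q∣≡1 (>⇒≢ (x∈p∧y∈p∧x≢y⇒1<∣p∣ y∈p△q x∈p△q y≢x))
  where
  y∈p△q : y ∈ p △ q
  y∈p△q = x∈p∪q⁺ (inj₁ (x∈p∧x∉q⇒x∈p─q y∈p y∉q))
  x∈p△q : x ∈ p △ q
  x∈p△q = x∈p∪q⁺ (inj₂ (x∈p∧x∉q⇒x∈p─q x∈q x∉p))
  y≢x : y ≢ x
  y≢x y≡x = x∉p (subst (_∈ p) y≡x y∈p)

Lift-∪⁅⁆ : ∀ {P : Fin n → Set} → Lift P p → P x → Lift P (p ∪ ⁅ x ⁆)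
Lift-∪⁅⁆ {p = p} {x} {P} Pp Px u∈ with x∈p∪q⁻ p ⁅ x ⁆ u∈
... | inj₁ u∈p   = Pp u∈p
... | inj₂ u∈⁅x⁆ = subst P (sym (x∈⁅y⁆⇒x≡y x u∈⁅x⁆)) Px

pigeonhole : ∀ (K X : Subset n) (P : Fin n → Subset n) → ∣ K ∣ < ∣ X ∣ →
  (∀ {u v v'} → u ∈ K → v ∈ X → v' ∈ X → u ∈ P v → u ∈ P v' → v ≡ v') →
  ∃ λ v → v ∈ X × Empty (P v ∩ K)
pigeonhole {n} K₀ X₀ P = go ∣ K₀ ∣ K₀ X₀ ≤-refl
  where
  go : ∀ k (K X : Subset n) → ∣ K ∣ ≤ k → ∣ K ∣ < ∣ X ∣ →
    (∀ {u v v'} → u ∈ K → v ∈ X → v' ∈ X → u ∈ P v → u ∈ P v' → v ≡ v') →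
    ∃ λ v → v ∈ X × Empty (P v ∩ K)
  go k K X ∣K∣≤k ∣K∣<∣X∣ unique with 0<∣p∣⇒Nonempty (≤-trans (s≤s z≤n) ∣K∣<∣X∣)
  ... | v , v∈X with nonempty? (P v ∩ K)
  ...   | no  Pv∩K=∅ = v , v∈X , Pv∩K=∅
  ...   | yes (u , u∈Pv∩K) with x∈p∩q⁻ (P v) K u∈Pv∩K | k
  ...     | _ , u∈K | zero = contradiction ∣K∣≤k (<⇒≱ (x∈p⇒0<∣p∣ u∈K))
  ...     | u∈Pv , u∈K | suc k
    with go k (K - u) (X - v)
            (≤-pred (≤-trans (x∈p⇒∣p-x∣<∣p∣ u∈K) ∣K∣≤k))
            (≤-pred (≤-trans (s≤s (x∈p⇒∣p-x∣<∣p∣ u∈K)) (≤-trans ∣K∣<∣X∣ (∣p∣≤1+∣p-x∣ X v))))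
            (λ w∈ v₁∈ v₂∈ → unique (p─q⊆p K _ w∈) (p─q⊆p X _ v₁∈) (p─q⊆p X _ v₂∈))
  ... | v' , v'∈X-v , Pv'∩K-u=∅ = v' , p─q⊆p X _ v'∈X-v , Pv'∩K=∅
    where
    Pv'∩K=∅ : Empty (P v' ∩ K)
    Pv'∩K=∅ (w , w∈Pv'∩K) with x∈p∩q⁻ (P v') K w∈Pv'∩K | w ≟ᶠ u
    ... | w∈Pv' , _ | yes refl =
      x∈p─q⇒x∉q X ⁅ v ⁆ v'∈X-v
        (subst (_∈ ⁅ v ⁆) (unique u∈K v∈X (p─q⊆p X _ v'∈X-v) u∈Pv w∈Pv') (x∈⁅x⁆ v))
    ... | w∈Pv' , w∈K | no w≢u =
      Pv'∩K-u=∅ (w , x∈p∩q⁺ (w∈Pv' , x∈p∧x≢y⇒x∈p-y w∈K w≢u))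

module _ {n : ℕ} (G : Graph n) where

  ∈N⇒adj : ∀ {u v} → u ∈ N G v → adj G v u ≡ true
  ∈N⇒adj {u} {v} u∈Nv = trans (sym (lookup∘tabulate (adj G v) u)) ([]=⇒lookup u∈Nv)

  adj⇒∈N : ∀ {u v} → adj G v u ≡ true → u ∈ N G v
  adj⇒∈N {u} {v} uv = lookup⇒[]= u (N G v) (trans (lookup∘tabulate (adj G v) u) uv)

  v∈N[v] : ∀ v → v ∈ N[_] G v
  v∈N[v] v = x∈p∪q⁺ (inj₂ (x∈⁅x⁆ v))

  independent-N[] : ∀ {I u v} → Independent G I → v ∈ I → u ∈ I → u ∈ N[_] G v → u ≡ v
  independent-N[] {I} {u} {v} ind v∈I u∈I u∈N[v] with x∈p∪q⁻ (N G v) ⁅ v ⁆ u∈N[v]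
  ... | inj₁ u∈Nv with () ← trans (sym (∈N⇒adj u∈Nv)) (ind v u v∈I u∈I)
  ... | inj₂ u∈⁅v⁆ = x∈⁅y⁆⇒x≡y v u∈⁅v⁆

  add-step : ∀ {l K v} → Valid G l K → Empty (N[_] G v ∩ K) → TARStep G l K (K ∪ ⁅ v ⁆)
  add-step {l} {K} {v} (indK , l≤∣K∣) N[v]∩K=∅ =
    (indK , l≤∣K∣) , (indK' , l≤∣K'∣) , ∣p△p∪⁅x⁆∣≡1 K v v∉K
    where
    avoids : ∀ {u} → u ∈ N[_] G v → u ∉ K
    avoids u∈N[v] u∈K = N[v]∩K=∅ (_ , x∈p∩q⁺ (u∈N[v] , u∈K))
    v∉K : v ∉ K
    v∉K = avoids (v∈N[v] v)
    non-adj : ∀ {u} → u ∈ K → adj G v u ≡ false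
    non-adj {u} u∈K with adj G v u in vu
    ... | true  = contradiction u∈K (avoids (x∈p∪q⁺ (inj₁ (adj⇒∈N vu))))
    ... | false = refl
    indK' : Independent G (K ∪ ⁅ v ⁆)
    indK' u w u∈ w∈ with x∈p∪q⁻ K ⁅ v ⁆ u∈ | x∈p∪q⁻ K ⁅ v ⁆ w∈
    ... | inj₁ u∈K | inj₁ w∈K = indK u w u∈K w∈K
    ... | inj₁ u∈K | inj₂ w∈⁅v⁆ rewrite x∈⁅y⁆⇒x≡y v w∈⁅v⁆ = trans (adj-sym G u v) (non-adj u∈K)
    ... | inj₂ u∈⁅v⁆ | inj₁ w∈K rewrite x∈⁅y⁆⇒x≡y v u∈⁅v⁆ = non-adj w∈K
    ... | inj₂ u∈⁅v⁆ | inj₂ w∈⁅v⁆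
      rewrite x∈⁅y⁆⇒x≡y v u∈⁅v⁆ | x∈⁅y⁆⇒x≡y v w∈⁅v⁆ = adj-irrefl G v
    l≤∣K'∣ : l ≤ ∣ K ∪ ⁅ v ⁆ ∣
    l≤∣K'∣ = subst (l ≤_) (sym (∣p∪⁅x⁆∣≡1+∣p∣ K v v∉K)) (m≤n⇒m≤1+n l≤∣K∣)

zipWith-insertAt : ∀ {A B C : Set} (f : A → B → C) (xs : Vec A n) (ys : Vec B n) i x y →
  zipWith f (insertAt xs i x) (insertAt ys i y) ≡ insertAt (zipWith f xs ys) i (f x y)
zipWith-insertAt f xs       ys       zero    x y = refl
zipWith-insertAt f (x' ∷ xs) (y' ∷ ys) (suc i) x y = cong (f x' y' ∷_) (zipWith-insertAt f xs ys i x y)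

∣insertAt-outside∣ : ∀ (p : Subset n) i → ∣ insertAt p i outside ∣ ≡ ∣ p ∣
∣insertAt-outside∣ p             zero    = refl
∣insertAt-outside∣ (inside ∷ p)  (suc i) = cong suc (∣insertAt-outside∣ p i)
∣insertAt-outside∣ (outside ∷ p) (suc i) = ∣insertAt-outside∣ p i

insertAt-restrict : ∀ (p : Subset (suc m)) i → i ∉ p → insertAt (restrict p i) i outside ≡ p
insertAt-restrict         (outside ∷ p) zero    _   = cong (outside ∷_) (tabulate∘lookup p)
insertAt-restrict         (inside ∷ p)  zero    i∉p = contradiction here i∉p
insertAt-restrict {suc m} (s ∷ p)       (suc i) i∉p = cong (s ∷_) (insertAt-restrict p i (i∉p ∘ there))

module _ {n : ℕ} (G : Graph n) (l : ℕ) (b : Fin n) where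

  AvoidingStep : Subset n → Subset n → Set
  AvoidingStep X Y = TARStep G l X Y × b ∉ X × b ∉ Y

  ReachesLargeAvoiding : ℕ → Subset n → Set
  ReachesLargeAvoiding s K = Σ (Subset n) λ K' → s ≤ ∣ K' ∣ × b ∉ K' × Star AvoidingStep K K'

module _ {m : ℕ} (G : Graph (suc m)) (b : Fin (suc m)) where

  private
    G-b : Graph m
    G-b = deleteVertex G b

  extend : Subset m → Subset (suc m)
  extend J = insertAt J b outside

  b∉extend : ∀ J → b ∉ extend J
  b∉extend J = lookup≡outside⇒∉ (insertAt-lookup J b outside)

  ∈-extend⁺ : ∀ {J x} → x ∈ J → punchIn b x ∈ extend J
  ∈-extend⁺ {J} {x} x∈J = lookup⇒[]= _ _ (trans (insertAt-punchIn J b outside x) ([]=⇒lookup x∈J))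

  ∈-extend⁻ : ∀ {J u} → u ∈ extend J → ∃ λ x → x ∈ J × punchIn b x ≡ u
  ∈-extend⁻ {J} {u} u∈ with b ≟ᶠ u
  ... | yes refl = contradiction u∈ (b∉extend J)
  ... | no  b≢u  = punchOut b≢u , lookup⇒[]= _ J lookup≡inside , punchIn-punchOut b≢u
    where
    lookup≡inside : lookup J (punchOut b≢u) ≡ inside
    lookup≡inside = begin
      lookup J (punchOut b≢u)                          ≡⟨ insertAt-punchIn J b outside _ ⟨
      lookup (extend J) (punchIn b (punchOut b≢u))    ≡⟨ cong (lookup (extend J)) (punchIn-punchOut b≢u) ⟩
      lookup (extend J) u                              ≡⟨ []=⇒lookup u∈ ⟩
      inside                                           ∎
      where open ≡-Reasoning

  extend-△ : ∀ J K → extend J △ extend K ≡ extend (J △ K)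
  extend-△ J K = trans
    (cong₂ _∪_ (zipWith-insertAt _ J K b outside outside) (zipWith-insertAt _ K J b outside outside))
    (zipWith-insertAt _ (J ─ K) (K ─ J) b outside outside)

  independent-extend⇔ : ∀ {J} → Independent G-b J ⇔ Independent G (extend J)
  independent-extend⇔ = mk⇔ to from
    where
    to : ∀ {J} → Independent G-b J → Independent G (extend J)
    to ind u v u∈ v∈ with ∈-extend⁻ u∈ | ∈-extend⁻ v∈
    ... | x , x∈J , refl | y , y∈J , refl = ind x y x∈J y∈J
    from : ∀ {J} → Independent G (extend J) → Independent G-b J
    from ind x y x∈J y∈J = ind (punchIn b x) (punchIn b y) (∈-extend⁺ x∈J) (∈-extend⁺ y∈J)

  valid-extend⇔ : ∀ {l J} → Valid G-b l J ⇔ Valid G l (extend J)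
  valid-extend⇔ {l} {J} = mk⇔
    (λ (ind , l≤) → Equivalence.to independent-extend⇔ ind , subst (l ≤_) (sym (∣insertAt-outside∣ J b)) l≤)
    (λ (ind , l≤) → Equivalence.from independent-extend⇔ ind , subst (l ≤_) (∣insertAt-outside∣ J b) l≤)

  TARStep-extend⇔ : ∀ {l J K} → TARStep G-b l J K ⇔ TARStep G l (extend J) (extend K)
  TARStep-extend⇔ {l} {J} {K} = mk⇔
    (λ (vJ , vK , Δ) →
      Equivalence.to valid-extend⇔ vJ , Equivalence.to valid-extend⇔ vK , trans ∣extend-△∣ Δ)
    (λ (vJ , vK , Δ) →
      Equivalence.from valid-extend⇔ vJ , Equivalence.from valid-extend⇔ vK , trans (sym ∣extend-△∣) Δ)
    where
    ∣extend-△∣ : ∣ extend J △ extend K ∣ ≡ ∣ J △ K ∣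
    ∣extend-△∣ = trans (cong ∣_∣ (extend-△ J K)) (∣insertAt-outside∣ (J △ K) b)

  yes-extend : ∀ {l s Iini} → b ∉ Iini → YesInstance G-b l (restrict Iini b) s → YesInstance G l Iini s
  yes-extend {l} {s} {Iini} b∉Iini (J , s≤∣J∣ , vIini , path) =
    extend J , subst (s ≤_) (sym (∣insertAt-outside∣ J b)) s≤∣J∣ ,
    subst (Valid G l) Iini≡ (Equivalence.to valid-extend⇔ vIini) ,
    subst (λ X → Star (TARStep G l) X (extend J)) Iini≡ (gmap extend (Equivalence.to TARStep-extend⇔) path)
    where
    Iini≡ : extend (restrict Iini b) ≡ Iini
    Iini≡ = insertAt-restrict Iini b b∉Iini

  yes-restrict : ∀ {l s Iini} → b ∉ Iini → Valid G l Iini → ReachesLargeAvoiding G l b s Iini →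
    YesInstance G-b l (restrict Iini b) s
  yes-restrict {l} {s} {Iini} b∉Iini vIini (K , s≤∣K∣ , b∉K , path) =
    restrict K b , subst (s ≤_) (∣restrict∣ b∉K) s≤∣K∣ ,
    Equivalence.from valid-extend⇔ (subst (Valid G l) (sym (insertAt-restrict Iini b b∉Iini)) vIini) ,
    gmap (λ X → restrict X b) restrict-step path
    where
    ∣restrict∣ : ∀ {X} → b ∉ X → ∣ X ∣ ≡ ∣ restrict X b ∣
    ∣restrict∣ {X} b∉X = trans (cong ∣_∣ (sym (insertAt-restrict X b b∉X))) (∣insertAt-outside∣ _ b)
    restrict-step : ∀ {X Y} → AvoidingStep G l b X Y → TARStep G-b l (restrict X b) (restrict Y b)
    restrict-step {X} {Y} (step , b∉X , b∉Y) = Equivalence.from TARStep-extend⇔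
      (subst₂ (TARStep G l) (sym (insertAt-restrict X b b∉X)) (sym (insertAt-restrict Y b b∉Y)) step)

module _ {n : ℕ} (G : Graph n) {S C : Subset n} (sunflower : SunflowerNbhd G S C) where

  core⊆petal : ∀ {v v'} → v ∈ S → v' ∈ S → v ≢ v' → C ⊆ N[_] G v
  core⊆petal v∈S v'∈S v≢v' u∈C =
    proj₁ (x∈p∩q⁻ _ _ (subst (_ ∈_) (sym (proj₂ sunflower _ _ v∈S v'∈S v≢v')) u∈C))

  petals-disjoint-off-core : ∀ {u v v'} → u ∉ C → v ∈ S → v' ∈ S →
    u ∈ N[_] G v → u ∈ N[_] G v' → v ≡ v'
  petals-disjoint-off-core {u} {v} {v'} u∉C v∈S v'∈S u∈N[v] u∈N[v'] with v ≟ᶠ v'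
  ... | yes v≡v' = v≡v'
  ... | no  v≢v' = contradiction
    (subst (u ∈_) (proj₂ sunflower _ _ v∈S v'∈S v≢v') (x∈p∩q⁺ (u∈N[v] , u∈N[v']))) u∉C

  -- The core lies in every petal, so the other members of S ∩ C are all
  -- adjacent to the one that degeneracy provides.
  ∣S∩C∣≤1+d : ∀ {d} → Degenerate G d → ∣ S ∩ C ∣ ≤ suc d
  ∣S∩C∣≤1+d {d} degenerate with nonempty? (S ∩ C)
  ... | no  S∩C=∅ = subst (_≤ suc d) (sym (Empty⇒∣p∣≡0 S∩C=∅)) z≤n
  ... | yes S∩C≠∅ with degenerate (S ∩ C) S∩C≠∅
  ...   | v , v∈S∩C , ∣Nv∩S∩C∣≤d = begin
    ∣ S ∩ C ∣                ≤⟨ ∣p∣≤1+∣p-x∣ (S ∩ C) v ⟩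
    suc ∣ S ∩ C - v ∣        ≤⟨ s≤s (p⊆q⇒∣p∣≤∣q∣ S∩C-v⊆Nv) ⟩
    suc ∣ N G v ∩ (S ∩ C) ∣  ≤⟨ s≤s ∣Nv∩S∩C∣≤d ⟩
    suc d                    ∎
    where
    open ≤-Reasoning
    S∩C-v⊆Nv : S ∩ C - v ⊆ N G v ∩ (S ∩ C)
    S∩C-v⊆Nv {w} w∈ with x∈p∩q⁻ S C (p─q⊆p _ _ w∈)
    ... | w∈S , w∈C
      with x∈p∪q⁻ (N G v) ⁅ v ⁆ (core⊆petal (proj₁ (x∈p∩q⁻ S C v∈S∩C)) w∈S v≢w w∈C)
      where
      v≢w : v ≢ w
      v≢w = ≢-sym (x∉⁅y⁆⇒x≢y (x∈p─q⇒x∉q _ _ w∈))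
    ...   | inj₁ w∈Nv  = x∈p∩q⁺ (w∈Nv , p─q⊆p _ _ w∈)
    ...   | inj₂ w∈⁅v⁆ = contradiction w∈⁅v⁆ (x∈p─q⇒x∉q _ _ w∈)

  ∣S∣≤∣S─C-b∣+d+2 : ∀ {d} → Degenerate G d → ∀ b → ∣ S ∣ ≤ ∣ S ─ C - b ∣ + d + 2
  ∣S∣≤∣S─C-b∣+d+2 {d} degenerate b = begin
    ∣ S ∣                            ≤⟨ ∣p∣≤∣p─q∣+∣p∩q∣ S C ⟩
    ∣ S ─ C ∣ + ∣ S ∩ C ∣
      ≤⟨ +-mono-≤ (∣p∣≤1+∣p-x∣ (S ─ C) b) (∣S∩C∣≤1+d degenerate) ⟩
    suc ∣ S ─ C - b ∣ + suc d        ≡⟨ cong suc (+-suc _ d) ⟩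
    suc (suc (∣ S ─ C - b ∣ + d))    ≡⟨ +-comm 2 _ ⟩
    ∣ S ─ C - b ∣ + d + 2            ∎
    where open ≤-Reasoning

module _ {n : ℕ} (G : Graph n) (l s : ℕ) (b : Fin n) (C X : Subset n) where

  _◅-reaches_ : ∀ {K K'} → AvoidingStep G l b K K' →
    ReachesLargeAvoiding G l b s K' → ReachesLargeAvoiding G l b s K
  step ◅-reaches (K* , s≤∣K*∣ , b∉K* , path) = K* , s≤∣K*∣ , b∉K* , step ◅ path

  Fresh : Fin n → Set
  Fresh u = u ≢ b × u ∉ C

  b∉ : ∀ {Y} → Lift Fresh Y → b ∉ Y
  b∉ Y-fresh b∈Y = proj₁ (Y-fresh b∈Y) refl

  module _ (s≤∣X∣ : s ≤ ∣ X ∣) (X-fresh : Lift Fresh X)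
    (petals-disjoint : ∀ {u v v'} → u ∉ C → v ∈ X → v' ∈ X → u ∈ N[_] G v → u ∈ N[_] G v' → v ≡ v')
    where

    greedy : ∀ {K} → Valid G l K → Lift Fresh K → ReachesLargeAvoiding G l b s K
    greedy {K} = go s (m≤n+m s ∣ K ∣)
      where
      go : ∀ fuel {K} → s ≤ ∣ K ∣ + fuel → Valid G l K → Lift Fresh K → ReachesLargeAvoiding G l b s K
      go fuel {K} s≤ vK K-fresh with s ≤? ∣ K ∣
      go _          {K} _  vK K-fresh | yes s≤∣K∣ = K , s≤∣K∣ , b∉ K-fresh , ε
      go zero       {K} s≤ vK K-fresh | no  s≰∣K∣ = contradiction (subst (s ≤_) (+-identityʳ _) s≤) s≰∣K∣
      go (suc fuel) {K} s≤ vK K-fresh | no  s≰∣K∣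
        with pigeonhole K X (N[_] G) (<-≤-trans (≰⇒> s≰∣K∣) s≤∣X∣)
               (λ u∈K → petals-disjoint (proj₂ (K-fresh u∈K)))
      ... | v , v∈X , N[v]∩K=∅ = (step , b∉ K-fresh , b∉ K'-fresh) ◅-reaches go fuel s≤' vK' K'-fresh
        where
        step : TARStep G l K (K ∪ ⁅ v ⁆)
        step = add-step G vK N[v]∩K=∅
        vK' : Valid G l (K ∪ ⁅ v ⁆)
        vK' = proj₁ (proj₂ step)
        K'-fresh : Lift Fresh (K ∪ ⁅ v ⁆)
        K'-fresh = Lift-∪⁅⁆ K-fresh (X-fresh v∈X)
        v∉K : v ∉ K
        v∉K v∈K = N[v]∩K=∅ (v , x∈p∩q⁺ (v∈N[v] G v , v∈K))
        s≤' : s ≤ ∣ K ∪ ⁅ v ⁆ ∣ + fuel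
        s≤' = subst (s ≤_)
          (trans (+-suc ∣ K ∣ fuel) (cong (_+ fuel) (sym (∣p∪⁅x⁆∣≡1+∣p∣ K v v∉K)))) s≤

    first-entry : C ⊆ N[_] G b → ∀ {K J} → b ∉ K → Valid G l K →
      Star (TARStep G l) K J → s ≤ ∣ J ∣ → ReachesLargeAvoiding G l b s K
    first-entry C⊆N[b] b∉K vK ε s≤∣K∣ = _ , s≤∣K∣ , b∉K , ε
    first-entry C⊆N[b] {K} b∉K vK (_◅_ {j = K₁} step path) s≤∣J∣ with b ∈? K₁
    ... | no b∉K₁ =
      (step , b∉K , b∉K₁) ◅-reaches first-entry C⊆N[b] b∉K₁ (proj₁ (proj₂ step)) path s≤∣J∣
    ... | yes b∈K₁ = greedy vK K-fresh
      where
      K-fresh : Lift Fresh K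
      K-fresh {u} u∈K = u≢b , λ u∈C → u≢b (independent-N[] G indK₁ b∈K₁ u∈K₁ (C⊆N[b] u∈C))
        where
        indK₁ : Independent G K₁
        indK₁ = proj₁ (proj₁ (proj₂ step))
        u∈K₁ : u ∈ K₁
        u∈K₁ = ∣p△q∣≡1∧x∈q─p⇒p⊆q (proj₂ (proj₂ step)) b∉K b∈K₁ u∈K
        u≢b : u ≢ b
        u≢b u≡b = b∉K (subst (_∈ K) u≡b u∈K)

2s+d+1≤x+d+2⇒s≤x : ∀ s d x → 0 < s → 2 * s + d + 1 ≤ x + d + 2 → s ≤ x
2s+d+1≤x+d+2⇒s≤x s d x 0<s h = +-cancelʳ-≤ 1 s x (≤-trans (+-monoʳ-≤ s 0<s) s+s≤x+1)
  where
  open +-*-Solver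
  s+s≤x+1 : s + s ≤ x + 1
  s+s≤x+1 = +-cancelʳ-≤ (d + 1) (s + s) (x + 1) (subst₂ _≤_
    (solve 2 (λ s d → con 2 :* s :+ d :+ con 1 := (s :+ s) :+ (d :+ con 1)) refl s d)
    (solve 2 (λ x d → x :+ d :+ con 2 := (x :+ con 1) :+ (d :+ con 1)) refl x d)
    h)

lemma8 : {m : ℕ} (G : Graph (suc m)) (d l s : ℕ) (Iini : Subset (suc m)) →
    Degenerate G d →
    ∣ Iini ∣ < s →
    (∀ u v → u ∈ (lowDeg G d ─ Iini) → v ∈ (lowDeg G d ─ Iini) →
    N[_] G u ≡ N[_] G v → u ≡ v) →
    f s d < ∣ lowDeg G d ─ Iini ∣ →
    (S C : Subset (suc m)) →
    S ⊆ (lowDeg G d ─ Iini) →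
    ∣ S ∣ ≡ 2 * s + d + 1 →
    SunflowerNbhd G S C →
    (b : Fin (suc m)) → b ∈ S →
    YesInstance G l Iini s ⇔ YesInstance (deleteVertex G b) l (restrict Iini b) s
-- Twin-freeness and the bound |D'| > f(s,d) only serve to produce the sunflower,
-- which is given here.
lemma8 {m} G d l s Iini degenerate ∣Iini∣<s _ _ S C S⊆D' ∣S∣≡2s+d+1 sunflower b b∈S =
  mk⇔ forward (yes-extend G b b∉Iini)
  where
  b∉Iini : b ∉ Iini
  b∉Iini = x∈p─q⇒x∉q _ _ (S⊆D' b∈S)
  0<s : 0 < s
  0<s = ≤-trans (s≤s z≤n) ∣Iini∣<s
  X : Subset (suc m)
  X = S ─ C - b
  X⊆S : X ⊆ S
  X⊆S = p─q⊆p S C ∘ p─q⊆p (S ─ C) ⁅ b ⁆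
  X-fresh : ∀ {v} → v ∈ X → v ≢ b × v ∉ C
  X-fresh v∈X = x∉⁅y⁆⇒x≢y (x∈p─q⇒x∉q _ _ v∈X) , x∈p─q⇒x∉q S C (p─q⊆p _ _ v∈X)
  s≤∣X∣ : s ≤ ∣ X ∣
  s≤∣X∣ = 2s+d+1≤x+d+2⇒s≤x s d ∣ X ∣ 0<s
    (subst (_≤ ∣ X ∣ + d + 2) ∣S∣≡2s+d+1 (∣S∣≤∣S─C-b∣+d+2 G sunflower degenerate b))
  C⊆N[b] : C ⊆ N[_] G b
  C⊆N[b] with 0<∣p∣⇒Nonempty (≤-trans 0<s s≤∣X∣)
  ... | v , v∈X = core⊆petal G sunflower b∈S (X⊆S v∈X) (≢-sym (proj₁ (X-fresh v∈X)))
  forward : YesInstance G l Iini s → YesInstance (deleteVertex G b) l (restrict Iini b) s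
  forward (I , s≤∣I∣ , vIini , path) = yes-restrict G b b∉Iini vIini
    (first-entry G l s b C X s≤∣X∣ X-fresh
      (λ u∉C v∈X v'∈X → petals-disjoint-off-core G sunflower u∉C (X⊆S v∈X) (X⊆S v'∈X))
      C⊆N[b] b∉Iini vIini path s≤∣I∣)
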